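{- Let $a \in \mathbb{Z}^n$ be non-zero, $b\in\mathbb{Z}$, $\Delta=\lVert a\rVert_\infty$, and let $\mathcal{P}_I = \operatorname{Conv}(\{x\in\mathbb{R}^n : a^\top x = b,\ x\ge 0\}\cap\mathbb{Z}^n)$. For every vertex $v$ of $\mathcal{P}_I$ with $|\operatorname{supp}(v)|=s$ we have $s \le (3/2)\log(2.4\cdot\Delta)$.
   Context: All logarithms are base 2. $\operatorname{supp}(v)=\{i: v_i\neq 0\}$. A vertex of $\mathcal{P}_I$ is a point $v\in\mathcal{P}_I$ with $v\notin\operatorname{Conv}(\mathcal{P}_I\setminus\{v\})$.
   Formalization: The convex hull $\mathcal{P}_I$ is taken in ℚ^n rather than ℝ^n, with rational weights in its convex combinations and in the definition of vertex, so the vertices v have rational coordinates. -}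

module Defs where

open import Data.Nat as ℕ using (ℕ; zero; suc; _⊔_)
open import Data.Integer as ℤ using (ℤ; ∣_∣)
open import Data.Rational as ℚ using (ℚ; 0ℚ; 1ℚ; _/_)
open import Data.Rational.Properties using () renaming (_≟_ to _≟ℚ_)
open import Data.Fin using (Fin; zero; suc)
open import Data.List using (List; []; _∷_)
open import Data.List.Relation.Unary.All using (All)
open import Data.Product using (Σ; ∃; _×_; _,_; proj₁; proj₂)
open import Relation.Binary.PropositionalEquality using (_≡_; _≢_)
open import Relation.Nullary using (¬_; does)
open import Data.Bool using (if_then_else_)

∑ℤ : ∀ {n} → (Fin n → ℤ) → ℤ
∑ℤ {zero}  f = ℤ.+ 0
∑ℤ {suc n} f = f zero ℤ.+ ∑ℤ (λ i → f (suc i))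

dot : ∀ {n} → (Fin n → ℤ) → (Fin n → ℤ) → ℤ
dot a x = ∑ℤ (λ i → a i ℤ.* x i)

normInf : ∀ {n} → (Fin n → ℤ) → ℕ
normInf {zero}  a = 0
normInf {suc n} a = ∣ a zero ∣ ⊔ normInf (λ i → a (suc i))

NonZeroVec : ∀ {n} → (Fin n → ℤ) → Set
NonZeroVec a = ∃ λ i → a i ≢ ℤ.+ 0

IntFeasible : ∀ {n} → (Fin n → ℤ) → ℤ → (Fin n → ℤ) → Set
IntFeasible a b x = (∀ i → ℤ.+ 0 ℤ.≤ x i) × dot a x ≡ b

embed : ℤ → ℚ
embed z = z / 1

Pt : ℕ → Set
Pt n = Fin n → ℚ

_≈_ : ∀ {n} → Pt n → Pt n → Set
p ≈ q = ∀ i → p i ≡ q i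

combo : ∀ {n} → List (ℚ × Pt n) → Pt n
combo []              i = 0ℚ
combo ((l , p) ∷ ws)  i = l ℚ.* p i ℚ.+ combo ws i

weightSum : ∀ {n} → List (ℚ × Pt n) → ℚ
weightSum []             = 0ℚ
weightSum ((l , p) ∷ ws) = l ℚ.+ weightSum ws

InConv : ∀ {n} → (Pt n → Set) → Pt n → Set
InConv {n} X y = Σ (List (ℚ × Pt n)) λ ws →
  All (λ w → (0ℚ ℚ.≤ proj₁ w) × X (proj₂ w)) ws ×
  weightSum ws ≡ 1ℚ × (combo ws ≈ y)

PI : ∀ {n} → (Fin n → ℤ) → ℤ → Pt n → Set
PI a b = InConv (λ p → ∃ λ x → IntFeasible a b x × (∀ i → p i ≡ embed (x i)))

IsVertex : ∀ {n} → (Fin n → ℤ) → ℤ → Pt n → Set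
IsVertex a b v = PI a b v × ¬ InConv (λ p → PI a b p × ¬ (p ≈ v)) v

suppSize : ∀ {n} → Pt n → ℕ
suppSize {zero}  v = 0
suppSize {suc n} v = (if does (v zero ≟ℚ 0ℚ) then 0 else 1) ℕ.+ suppSize (λ i → v (suc i))

-- Let v be a vertex of P_I with support S of size s, and Δ = ‖a‖∞ ≥ 1.
--  (1) v is one of the integer points generating P_I.
--  (2) The weights |aᵢ| admit no nonzero relation Σ |aᵢ| tᵢ = 0 with t ∈ {-1,0,1}ⁿ supported
--      on S: with wᵢ = sign(aᵢ) tᵢ both v + w and v − w are integer points of P_I, and v is
--      their midpoint.
--  (3) Hence the 2^s subset sums Σ_{i ∈ T} |aᵢ| (T ⊆ S) are pairwise distinct; they lie in
--      [0, s·Δ], so 2^s ≤ s·Δ + 1 by the pigeonhole principle.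
--  (4) Arithmetic turns 2^s ≤ s·Δ + 1 into 4^s ≤ (2.4·Δ)³, i.e. s ≤ (3/2) log(2.4·Δ).

module Submission where

open import Defs
open import Data.Nat using (ℕ; zero; suc; _+_; _*_; _^_; _≤_; z≤n; s≤s)
open import Data.Nat.Properties
  using (≤-trans; m≤n+m; m≤m+n; m≤m⊔n; m≤n⊔m; +-mono-≤; +-monoˡ-≤; +-identityʳ; +-cancelˡ-≡;
         *-monoʳ-≤; *-monoˡ-≤; *-cancelʳ-≤; ^-monoˡ-≤; m^n≢0; n≢0⇒n>0; ≤ᵇ⇒≤; module ≤-Reasoning)
open import Data.Nat.Solver using () renaming (module +-*-Solver to ℕ-Poly)
open import Data.Integer as ℤ using (ℤ; +_; +[1+_]; -[1+_]; ∣_∣)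
import Data.Integer.Properties as ℤ
import Data.Integer.Tactic.RingSolver as ℤ-Solver
open import Algebra.Properties.AbelianGroup ℤ.+-0-abelianGroup using (identityʳ-unique)
open import Data.Rational as ℚ using (ℚ; 0ℚ; 1ℚ; ½)
import Data.Rational.Properties as ℚ
open import Data.Rational.Solver using () renaming (module +-*-Solver to ℚ-Poly)
open import Data.Rational.Unnormalised as ℚᵘ using (mkℚᵘ; *≡*)
import Data.Rational.Unnormalised.Properties as ℚᵘ
open import Data.Fin using (Fin; zero; suc; toℕ; fromℕ<)
open import Data.Fin.Properties using (injective⇒≤; toℕ-fromℕ<; all?)
open import Data.Vec.Functional using () renaming (_∷_ to _◂_)
open import Data.Bool using (Bool; true; false; if_then_else_)
open import Data.List as List using (List; []; _∷_; _++_; map; length)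
open import Data.List.Properties using (length-++; length-map)
open import Data.List.Membership.Propositional using (_∈_)
open import Data.List.Membership.Propositional.Properties using (∈-map⁻; ∈-++⁻; ∈-lookup)
open import Data.List.Relation.Unary.All as All using (All; []; _∷_)
open import Data.List.Relation.Unary.All.Properties using (++⁺; map⁺)
open import Data.List.Relation.Unary.Any using (here)
open import Data.List.Relation.Unary.AllPairs using (_∷_)
open import Data.List.Relation.Unary.Unique.Propositional using (Unique; [])
import Data.List.Relation.Unary.Unique.Propositional.Properties as Unique
open import Data.Product using (∃; _×_; _,_; proj₁; proj₂)
open import Data.Sum using (_⊎_; inj₁; inj₂)
open import Data.Empty using (⊥; ⊥-elim)
open import Data.Unit using (tt)
open import Function using (_∘_)
open import Relation.Nullary using (¬_; yes; no; does)
open import Relation.Nullary.Decidable using (dec-true)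
open import Relation.Binary.PropositionalEquality

dot-+ʳ : ∀ {n} (a x y : Fin n → ℤ) → dot a (λ i → x i ℤ.+ y i) ≡ dot a x ℤ.+ dot a y
dot-+ʳ {zero}  a x y = refl
dot-+ʳ {suc n} a x y =
  trans (cong (λ r → a zero ℤ.* (x zero ℤ.+ y zero) ℤ.+ r) (dot-+ʳ (a ∘ suc) (x ∘ suc) (y ∘ suc)))
        (regroup (a zero) (x zero) (y zero) (dot (a ∘ suc) (x ∘ suc)) (dot (a ∘ suc) (y ∘ suc)))
  where
  regroup : ∀ c p q r s → c ℤ.* (p ℤ.+ q) ℤ.+ (r ℤ.+ s) ≡ (c ℤ.* p ℤ.+ r) ℤ.+ (c ℤ.* q ℤ.+ s)
  regroup = ℤ-Solver.solve-∀

dot-negʳ : ∀ {n} (a x : Fin n → ℤ) → dot a (λ i → ℤ.- x i) ≡ ℤ.- dot a x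
dot-negʳ {zero}  a x = refl
dot-negʳ {suc n} a x =
  trans (cong (λ r → a zero ℤ.* ℤ.- x zero ℤ.+ r) (dot-negʳ (a ∘ suc) (x ∘ suc)))
        (regroup (a zero) (x zero) (dot (a ∘ suc) (x ∘ suc)))
  where
  regroup : ∀ c p r → c ℤ.* ℤ.- p ℤ.+ ℤ.- r ≡ ℤ.- (c ℤ.* p ℤ.+ r)
  regroup = ℤ-Solver.solve-∀

dot-−ʳ : ∀ {n} (a x y : Fin n → ℤ) → dot a (λ i → x i ℤ.- y i) ≡ dot a x ℤ.- dot a y
dot-−ʳ a x y = trans (dot-+ʳ a x (ℤ.-_ ∘ y)) (cong (λ r → dot a x ℤ.+ r) (dot-negʳ a y))

dot-cong : ∀ {n} {a x c y : Fin n → ℤ} → (∀ i → a i ℤ.* x i ≡ c i ℤ.* y i) → dot a x ≡ dot c y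
dot-cong {zero}  eq = refl
dot-cong {suc n} {a} {x} {c} {y} eq =
  cong₂ ℤ._+_ (eq zero) (dot-cong {a = a ∘ suc} {x ∘ suc} {c ∘ suc} {y ∘ suc} (eq ∘ suc))

dot-zero-head : ∀ {n} (a : Fin (suc n) → ℤ) (x : Fin n → ℤ) → dot a (+ 0 ◂ x) ≡ dot (a ∘ suc) x
dot-zero-head a x = trans (cong (ℤ._+ dot (a ∘ suc) x) (ℤ.*-zeroʳ (a zero))) (ℤ.+-identityˡ _)

lookup-injective : ∀ {A : Set} {xs : List A} → Unique xs →
  ∀ {i j} → List.lookup xs i ≡ List.lookup xs j → i ≡ j
lookup-injective (_ ∷ _)    {zero}  {zero}  _  = refl
lookup-injective (x∉ ∷ _)   {zero}  {suc j} eq = ⊥-elim (All.lookup x∉ (∈-lookup j) eq)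
lookup-injective (x∉ ∷ _)   {suc i} {zero}  eq = ⊥-elim (All.lookup x∉ (∈-lookup i) (sym eq))
lookup-injective (_ ∷ uniq) {suc i} {suc j} eq = cong suc (lookup-injective uniq eq)

unique-bounded-length : ∀ {xs : List ℕ} W → Unique xs → All (_≤ W) xs → length xs ≤ suc W
unique-bounded-length {xs} W uniq bounded = injective⇒≤ {f = position} position-injective
  where
  position : Fin (length xs) → Fin (suc W)
  position k = fromℕ< (s≤s (All.lookup bounded (∈-lookup k)))
  position-injective : ∀ {i j} → position i ≡ position j → i ≡ j
  position-injective eq = lookup-injective uniq
    (trans (sym (toℕ-fromℕ< _)) (trans (cong toℕ eq) (toℕ-fromℕ< _)))

-- A zero pattern z : Fin n → Bool marks the coordinates outside a support (z i = true);
-- supportCount z is the size of that support.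
supportCount : ∀ {n} → (Fin n → Bool) → ℕ
supportCount {zero}  z = 0
supportCount {suc n} z = (if z zero then 0 else 1) + supportCount (z ∘ suc)

asℤ : ∀ {n} → (Fin n → ℕ) → Fin n → ℤ
asℤ A i = + A i

RelationFree : ∀ {n} → (Fin n → ℕ) → (Fin n → Bool) → Set
RelationFree {n} A z = (t : Fin n → ℤ) → (∀ i → ∣ t i ∣ ≤ 1) → (∀ i → z i ≡ true → t i ≡ + 0) →
  dot (asℤ A) t ≡ + 0 → ∀ i → t i ≡ + 0

relationFree-tail : ∀ {n} (A : Fin (suc n) → ℕ) z → RelationFree A z → RelationFree (A ∘ suc) (z ∘ suc)
relationFree-tail A z free t t≤1 t-off t-rel i = free (+ 0 ◂ t) bounded off relation (suc i)
  where
  bounded : ∀ i → ∣ (+ 0 ◂ t) i ∣ ≤ 1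
  bounded zero    = z≤n
  bounded (suc i) = t≤1 i
  off : ∀ i → z i ≡ true → (+ 0 ◂ t) i ≡ + 0
  off zero    _ = refl
  off (suc i) = t-off i
  relation : dot (asℤ A) (+ 0 ◂ t) ≡ + 0
  relation = trans (dot-zero-head (asℤ A) t) t-rel

extend : Bool → ℕ → List ℕ → List ℕ
extend true  a sums = sums
extend false a sums = sums ++ map (λ s → a + s) sums

subsetSums : ∀ {n} → (Fin n → ℕ) → (Fin n → Bool) → List ℕ
subsetSums {zero}  A z = 0 ∷ []
subsetSums {suc n} A z = extend (z zero) (A zero) (subsetSums (A ∘ suc) (z ∘ suc))

subsetSums-length : ∀ {n} (A : Fin n → ℕ) z → length (subsetSums A z) ≡ 2 ^ supportCount z
subsetSums-length {zero}  A z = refl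
subsetSums-length {suc n} A z with z zero
... | true  = subsetSums-length (A ∘ suc) (z ∘ suc)
... | false = begin
    length (sums ++ map (λ s → A zero + s) sums)       ≡⟨ length-++ sums ⟩
    length sums + length (map (λ s → A zero + s) sums) ≡⟨ cong (λ k → length sums + k) (length-map _ sums) ⟩
    length sums + length sums                          ≡⟨ cong (λ k → k + k) (subsetSums-length (A ∘ suc) (z ∘ suc)) ⟩
    2 ^ c + 2 ^ c                                      ≡⟨ cong (λ k → 2 ^ c + k) (sym (+-identityʳ _)) ⟩
    2 ^ suc c                                          ∎
  where
  open ≡-Reasoning
  sums : List ℕ
  sums = subsetSums (A ∘ suc) (z ∘ suc)
  c : ℕ
  c = supportCount (z ∘ suc)

subsetSums-bounded : ∀ {n} (A : Fin n → ℕ) z Δ → (∀ i → A i ≤ Δ) →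
  All (_≤ supportCount z * Δ) (subsetSums A z)
subsetSums-bounded {zero}  A z Δ A≤Δ = z≤n ∷ []
subsetSums-bounded {suc n} A z Δ A≤Δ with z zero
... | true  = subsetSums-bounded (A ∘ suc) (z ∘ suc) Δ (A≤Δ ∘ suc)
... | false = ++⁺ (All.map (λ s≤ → ≤-trans s≤ (m≤n+m _ Δ)) tail-bounded)
                  (map⁺ (All.map (+-mono-≤ (A≤Δ zero)) tail-bounded))
  where
  tail-bounded : All (_≤ supportCount (z ∘ suc) * Δ) (subsetSums (A ∘ suc) (z ∘ suc))
  tail-bounded = subsetSums-bounded (A ∘ suc) (z ∘ suc) Δ (A≤Δ ∘ suc)

bit : Bool → ℤ
bit false = + 0
bit true  = + 1

bit-difference : ∀ p q → ∣ bit p ℤ.- bit q ∣ ≤ 1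
bit-difference false false = z≤n
bit-difference false true  = s≤s z≤n
bit-difference true  false = s≤s z≤n
bit-difference true  true  = z≤n

IsSubsetSum : ∀ {n} → (Fin n → ℕ) → (Fin n → Bool) → ℕ → Set
IsSubsetSum {n} A z s = ∃ λ (u : Fin n → Bool) →
  (∀ i → z i ≡ true → u i ≡ false) × dot (asℤ A) (bit ∘ u) ≡ + s

subsetSum-skip : ∀ {n} (A : Fin (suc n) → ℕ) z {s} → IsSubsetSum (A ∘ suc) (z ∘ suc) s → IsSubsetSum A z s
subsetSum-skip A z (u , u-off , u-sum) = (false ◂ u) , off , sum
  where
  off : ∀ i → z i ≡ true → (false ◂ u) i ≡ false
  off zero    _ = refl
  off (suc i) = u-off i
  sum : dot (asℤ A) (bit ∘ (false ◂ u)) ≡ _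
  sum = trans (dot-zero-head (asℤ A) (bit ∘ u)) u-sum

subsetSum-take : ∀ {n} (A : Fin (suc n) → ℕ) z {s} → z zero ≡ false →
  IsSubsetSum (A ∘ suc) (z ∘ suc) s → IsSubsetSum A z (A zero + s)
subsetSum-take A z {s} z₀ (u , u-off , u-sum) = (true ◂ u) , off , sum
  where
  off : ∀ i → z i ≡ true → (true ◂ u) i ≡ false
  off zero    z₀′ with () ← trans (sym z₀) z₀′
  off (suc i) = u-off i
  sum : + A zero ℤ.* + 1 ℤ.+ dot (asℤ (A ∘ suc)) (bit ∘ u) ≡ + (A zero + s)
  sum = trans (cong₂ ℤ._+_ (ℤ.*-identityʳ (+ A zero)) u-sum) (sym (ℤ.pos-+ (A zero) s))

subsetSums-sound : ∀ {n} (A : Fin n → ℕ) z {s} → s ∈ subsetSums A z → IsSubsetSum A z s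
subsetSums-sound {zero}  A z (here refl) = (λ ()) , (λ ()) , refl
subsetSums-sound {suc n} A z s∈ with z zero in z₀
... | true  = subsetSum-skip A z (subsetSums-sound (A ∘ suc) (z ∘ suc) s∈)
... | false with ∈-++⁻ (subsetSums (A ∘ suc) (z ∘ suc)) s∈
...   | inj₁ s∈sums = subsetSum-skip A z (subsetSums-sound (A ∘ suc) (z ∘ suc) s∈sums)
...   | inj₂ s∈shifted with ∈-map⁻ (λ s → A zero + s) s∈shifted
...     | s′ , s′∈sums , refl = subsetSum-take A z z₀ (subsetSums-sound (A ∘ suc) (z ∘ suc) s′∈sums)

-- Two subsets of the support, one containing coordinate 0 and one not, have different sums:
-- otherwise the difference of their indicators is a nontrivial {-1,0,1}-relation.
shifted-sums-disjoint : ∀ {n} (A : Fin (suc n) → ℕ) z → z zero ≡ false → RelationFree A z →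
  ∀ {s} → s ∈ subsetSums (A ∘ suc) (z ∘ suc) → s ∈ map (λ s → A zero + s) (subsetSums (A ∘ suc) (z ∘ suc)) →
  ⊥
shifted-sums-disjoint A z z₀ free s∈sums s∈shifted
  with ∈-map⁻ (λ s → A zero + s) s∈shifted
... | s′ , s′∈sums , refl
  with subsetSums-sound (A ∘ suc) (z ∘ suc) s∈sums | subsetSums-sound (A ∘ suc) (z ∘ suc) s′∈sums
... | u , u-off , u-sum | u′ , u′-off , u′-sum = -1≢0 (free t bounded off relation zero)
  where
  -1≢0 : -[1+ 0 ] ≢ + 0
  -1≢0 ()
  t : Fin (suc _) → ℤ
  t = -[1+ 0 ] ◂ (λ i → bit (u i) ℤ.- bit (u′ i))
  bounded : ∀ i → ∣ t i ∣ ≤ 1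
  bounded zero    = s≤s z≤n
  bounded (suc i) = bit-difference (u i) (u′ i)
  off : ∀ i → z i ≡ true → t i ≡ + 0
  off zero    z₀′ with () ← trans (sym z₀) z₀′
  off (suc i) zᵢ rewrite u-off i zᵢ | u′-off i zᵢ = refl
  cancel : ∀ a s → a ℤ.* -[1+ 0 ] ℤ.+ ((a ℤ.+ s) ℤ.- s) ≡ + 0
  cancel = ℤ-Solver.solve-∀
  relation : dot (asℤ A) t ≡ + 0
  relation = begin
    + A zero ℤ.* -[1+ 0 ] ℤ.+ dot (asℤ (A ∘ suc)) (λ i → bit (u i) ℤ.- bit (u′ i))
      ≡⟨ cong (λ r → + A zero ℤ.* -[1+ 0 ] ℤ.+ r) (dot-−ʳ (asℤ (A ∘ suc)) (bit ∘ u) (bit ∘ u′)) ⟩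
    + A zero ℤ.* -[1+ 0 ] ℤ.+ (dot (asℤ (A ∘ suc)) (bit ∘ u) ℤ.- dot (asℤ (A ∘ suc)) (bit ∘ u′))
      ≡⟨ cong₂ (λ p q → + A zero ℤ.* -[1+ 0 ] ℤ.+ (p ℤ.- q)) (trans u-sum (ℤ.pos-+ (A zero) s′)) u′-sum ⟩
    + A zero ℤ.* -[1+ 0 ] ℤ.+ ((+ A zero ℤ.+ + s′) ℤ.- + s′)
      ≡⟨ cancel (+ A zero) (+ s′) ⟩
    + 0 ∎
    where open ≡-Reasoning

subsetSums-unique : ∀ {n} (A : Fin n → ℕ) z → RelationFree A z → Unique (subsetSums A z)
subsetSums-unique {zero}  A z free = [] ∷ []
subsetSums-unique {suc n} A z free with z zero in z₀
... | true  = subsetSums-unique (A ∘ suc) (z ∘ suc) (relationFree-tail A z free)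
... | false = Unique.++⁺ tail-unique (Unique.map⁺ (+-cancelˡ-≡ (A zero) _ _) tail-unique)
                (λ (s∈sums , s∈shifted) → shifted-sums-disjoint A z z₀ free s∈sums s∈shifted)
  where
  tail-unique : Unique (subsetSums (A ∘ suc) (z ∘ suc))
  tail-unique = subsetSums-unique (A ∘ suc) (z ∘ suc) (relationFree-tail A z free)

relationFree-bound : ∀ {n} (A : Fin n → ℕ) z Δ → (∀ i → A i ≤ Δ) → RelationFree A z →
  2 ^ supportCount z ≤ suc (supportCount z * Δ)
relationFree-bound A z Δ A≤Δ free = begin
  2 ^ supportCount z          ≡⟨ subsetSums-length A z ⟨
  length (subsetSums A z)     ≤⟨ unique-bounded-length _ (subsetSums-unique A z free)
                                   (subsetSums-bounded A z Δ A≤Δ) ⟩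
  suc (supportCount z * Δ)    ∎
  where open ≤-Reasoning

-- The embedding ℤ → ℚ is an injective additive map; both facts are read off the
-- unnormalised representation z/1.
embed-as-ℚᵘ : ∀ z → ℚ.toℚᵘ (embed z) ℚᵘ.≃ mkℚᵘ z 0
embed-as-ℚᵘ z = ℚ.toℚᵘ-fromℚᵘ (mkℚᵘ z 0)

embed-+ : ∀ p q → embed (p ℤ.+ q) ≡ embed p ℚ.+ embed q
embed-+ p q = ℚ.toℚᵘ-injective (begin
  ℚ.toℚᵘ (embed (p ℤ.+ q))               ≈⟨ embed-as-ℚᵘ (p ℤ.+ q) ⟩
  mkℚᵘ (p ℤ.+ q) 0                       ≈⟨ *≡* (cross-multiplied p q) ⟩
  mkℚᵘ p 0 ℚᵘ.+ mkℚᵘ q 0                 ≈⟨ ℚᵘ.+-cong (embed-as-ℚᵘ p) (embed-as-ℚᵘ q) ⟨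
  ℚ.toℚᵘ (embed p) ℚᵘ.+ ℚ.toℚᵘ (embed q) ≈⟨ ℚ.toℚᵘ-homo-+ (embed p) (embed q) ⟨
  ℚ.toℚᵘ (embed p ℚ.+ embed q)           ∎)
  where
  open ℚᵘ.≃-Reasoning
  cross-multiplied : ∀ p q → (p ℤ.+ q) ℤ.* ℤ.1ℤ ≡ (p ℤ.* ℤ.1ℤ ℤ.+ q ℤ.* ℤ.1ℤ) ℤ.* ℤ.1ℤ
  cross-multiplied = ℤ-Solver.solve-∀

embed-injective : ∀ {p q} → embed p ≡ embed q → p ≡ q
embed-injective {p} {q} eq
  with ℚᵘ.≃-trans (ℚᵘ.≃-sym (embed-as-ℚᵘ p)) (ℚᵘ.≃-trans (ℚ.toℚᵘ-cong eq) (embed-as-ℚᵘ q))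
... | *≡* p≡q = trans (sym (ℤ.*-identityʳ p)) (trans p≡q (ℤ.*-identityʳ q))

midpoint : ∀ p q r → p ℚ.+ q ≡ r ℚ.+ r → ½ ℚ.* p ℚ.+ (½ ℚ.* q ℚ.+ 0ℚ) ≡ r
midpoint p q r p+q≡2r = trans (half-sum p q) (trans (cong (½ ℚ.*_) p+q≡2r) (half-double r))
  where
  open ℚ-Poly
  half-sum : ∀ p q → ½ ℚ.* p ℚ.+ (½ ℚ.* q ℚ.+ 0ℚ) ≡ ½ ℚ.* (p ℚ.+ q)
  half-sum = solve 2 (λ p q → con ½ :* p :+ (con ½ :* q :+ con 0ℚ) := con ½ :* (p :+ q)) refl
  half-double : ∀ r → ½ ℚ.* (r ℚ.+ r) ≡ r
  half-double = solve 1 (λ r → con ½ :* (r :+ r) := r) refl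

IntegerPoint : ∀ {n} → (Fin n → ℤ) → ℤ → Pt n → Set
IntegerPoint a b p = ∃ λ x → IntFeasible a b x × (∀ i → p i ≡ embed (x i))

integerPoint-in-PI : ∀ {n} {a : Fin n → ℤ} {b} {p : Pt n} → IntegerPoint a b p → PI a b p
integerPoint-in-PI {p = p} p-int =
  ((1ℚ , p) ∷ []) , ((ℚ.≤ᵇ⇒≤ tt , p-int) ∷ []) , ℚ.+-identityʳ 1ℚ ,
  λ i → trans (ℚ.+-identityʳ _) (ℚ.*-identityˡ (p i))

locate : ∀ {n} {a : Fin n → ℤ} {b} (v : Pt n) (ws : List (ℚ × Pt n)) →
  All (λ w → (0ℚ ℚ.≤ proj₁ w) × IntegerPoint a b (proj₂ w)) ws →
  IntegerPoint a b v ⊎ All (λ w → (0ℚ ℚ.≤ proj₁ w) × (PI a b (proj₂ w) × ¬ (proj₂ w ≈ v))) ws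
locate v [] [] = inj₂ []
locate {a = a} {b} v ((_ , p) ∷ ws) ((λ₀≥0 , p-int) ∷ ws-int) with all? (λ i → p i ℚ.≟ v i)
... | yes p≈v = inj₁ (let (x , x-feas , p≡x) = p-int in x , x-feas , λ i → trans (sym (p≈v i)) (p≡x i))
... | no p≉v with locate {a = a} {b} v ws ws-int
...   | inj₁ v-int = inj₁ v-int
...   | inj₂ rest  = inj₂ ((λ₀≥0 , integerPoint-in-PI {a = a} {b} p-int , p≉v) ∷ rest)

vertex-integral : ∀ {n} {a : Fin n → ℤ} {b} {v : Pt n} → IsVertex a b v → IntegerPoint a b v
vertex-integral {a = a} {b} {v} ((ws , ws-int , total , ws≈v) , not-combination)
  with locate {a = a} {b} v ws ws-int
... | inj₁ v-int = v-int
... | inj₂ ws-other = ⊥-elim (not-combination (ws , ws-other , total , ws≈v))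

stays-nonneg : ∀ {x c} → + 0 ℤ.≤ x → ∣ c ∣ ≤ 1 → (x ≡ + 0 → c ≡ + 0) → + 0 ℤ.≤ x ℤ.+ c
stays-nonneg {+ zero}   {c}             _ _        c-off rewrite c-off refl = ℤ.+≤+ z≤n
stays-nonneg {+[1+ m ]} {+ k}           _ _        _ = ℤ.+≤+ z≤n
stays-nonneg {+[1+ m ]} { -[1+ 0 ] }    _ _        _ = ℤ.+≤+ z≤n
stays-nonneg {+[1+ m ]} { -[1+ suc k ]} _ (s≤s ()) _

shift-feasible : ∀ {n} {a : Fin n → ℤ} {b} {x c : Fin n → ℤ} → IntFeasible a b x →
  (∀ i → ∣ c i ∣ ≤ 1) → (∀ i → x i ≡ + 0 → c i ≡ + 0) → dot a c ≡ + 0 →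
  IntFeasible a b (λ i → x i ℤ.+ c i)
shift-feasible {a = a} {b} {x} {c} (x≥0 , ax≡b) c≤1 c-off ac≡0 =
  (λ i → stays-nonneg (x≥0 i) (c≤1 i) (c-off i)) ,
  trans (dot-+ʳ a x c) (trans (cong₂ ℤ._+_ ax≡b ac≡0) (ℤ.+-identityʳ b))

shifted-point : ∀ {n} {a : Fin n → ℤ} {b} {v : Pt n} {x c : Fin n → ℤ} {j} →
  IntFeasible a b x → (∀ i → v i ≡ embed (x i)) →
  (∀ i → ∣ c i ∣ ≤ 1) → (∀ i → x i ≡ + 0 → c i ≡ + 0) → dot a c ≡ + 0 → c j ≢ + 0 →
  PI a b (λ i → embed (x i ℤ.+ c i)) × ¬ ((λ i → embed (x i ℤ.+ c i)) ≈ v)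
shifted-point {a = a} {b} {x = x} {c} {j} x-feas v≡x c≤1 c-off ac≡0 cⱼ≢0 =
  integerPoint-in-PI {a = a} {b} (_ , shift-feasible {a = a} x-feas c≤1 c-off ac≡0 , λ _ → refl) ,
  λ same → cⱼ≢0 (identityʳ-unique (x j) (c j) (embed-injective (trans (same j) (v≡x j))))

midpoint-of-shifts : ∀ {n} {a : Fin n → ℤ} {b} {v : Pt n} {x w : Fin n → ℤ} {j} →
  IntFeasible a b x → (∀ i → v i ≡ embed (x i)) →
  (∀ i → ∣ w i ∣ ≤ 1) → (∀ i → x i ≡ + 0 → w i ≡ + 0) → dot a w ≡ + 0 → w j ≢ + 0 →
  InConv (λ p → PI a b p × ¬ (p ≈ v)) v
midpoint-of-shifts {n} {a} {b} {v} {x} {w} {j} x-feas v≡x w≤1 w-off aw≡0 wⱼ≢0 =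
  ((½ , up) ∷ (½ , down) ∷ []) ,
  ((ℚ.≤ᵇ⇒≤ tt , shifted-point {a = a} {b} {c = w} x-feas v≡x w≤1 w-off aw≡0 wⱼ≢0) ∷
   (ℚ.≤ᵇ⇒≤ tt , shifted-point {a = a} {b} {c = ℤ.-_ ∘ w} x-feas v≡x -w≤1 -w-off a·-w≡0 -wⱼ≢0) ∷ []) ,
  refl ,
  λ i → midpoint (up i) (down i) (v i) (shifts-sum i)
  where
  up down : Pt n
  up   i = embed (x i ℤ.+ w i)
  down i = embed (x i ℤ.+ ℤ.- w i)
  -w≤1 : ∀ i → ∣ ℤ.- w i ∣ ≤ 1
  -w≤1 i = subst (_≤ 1) (sym (ℤ.∣-i∣≡∣i∣ (w i))) (w≤1 i)
  -w-off : ∀ i → x i ≡ + 0 → ℤ.- w i ≡ + 0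
  -w-off i xᵢ≡0 = cong ℤ.-_ (w-off i xᵢ≡0)
  a·-w≡0 : dot a (λ i → ℤ.- w i) ≡ + 0
  a·-w≡0 = trans (dot-negʳ a w) (cong ℤ.-_ aw≡0)
  -wⱼ≢0 : ℤ.- w j ≢ + 0
  -wⱼ≢0 e = wⱼ≢0 (ℤ.neg-injective e)
  opposite : ∀ p q → (p ℤ.+ q) ℤ.+ (p ℤ.+ ℤ.- q) ≡ p ℤ.+ p
  opposite = ℤ-Solver.solve-∀
  shifts-sum : ∀ i → up i ℚ.+ down i ≡ v i ℚ.+ v i
  shifts-sum i = begin
    up i ℚ.+ down i                           ≡⟨ embed-+ (x i ℤ.+ w i) (x i ℤ.+ ℤ.- w i) ⟨
    embed ((x i ℤ.+ w i) ℤ.+ (x i ℤ.+ ℤ.- w i)) ≡⟨ cong embed (opposite (x i) (w i)) ⟩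
    embed (x i ℤ.+ x i)                        ≡⟨ embed-+ (x i) (x i) ⟩
    embed (x i) ℚ.+ embed (x i)                ≡⟨ cong₂ ℚ._+_ (v≡x i) (v≡x i) ⟨
    v i ℚ.+ v i                                ∎
    where open ≡-Reasoning

-- Multiplying t by the sign of c turns c·t into |c|·t; this transfers relations
-- among the |aᵢ| to solutions of a·w = 0.
alignSign : ℤ → ℤ → ℤ
alignSign (+ _)    t = t
alignSign -[1+ _ ] t = ℤ.- t

alignSign-* : ∀ c t → c ℤ.* alignSign c t ≡ + ∣ c ∣ ℤ.* t
alignSign-* (+ _)    t = refl
alignSign-* -[1+ m ] t = negated-twice (+ suc m) t
  where
  negated-twice : ∀ p q → ℤ.- p ℤ.* ℤ.- q ≡ p ℤ.* q
  negated-twice = ℤ-Solver.solve-∀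

alignSign-∣∣ : ∀ c t → ∣ alignSign c t ∣ ≡ ∣ t ∣
alignSign-∣∣ (+ _)    t = refl
alignSign-∣∣ -[1+ _ ] t = ℤ.∣-i∣≡∣i∣ t

alignSign-zero : ∀ c {t} → t ≡ + 0 → alignSign c t ≡ + 0
alignSign-zero (+ _)    t≡0  = t≡0
alignSign-zero -[1+ _ ] refl = refl

alignSign-nonzero : ∀ c {t} → t ≢ + 0 → alignSign c t ≢ + 0
alignSign-nonzero (+ _)    t≢0 = t≢0
alignSign-nonzero -[1+ _ ] t≢0 e = t≢0 (ℤ.neg-injective e)

zeroPattern : ∀ {n} → Pt n → Fin n → Bool
zeroPattern v i = does (v i ℚ.≟ 0ℚ)

-- Key step: at a vertex v of P_I the weights |aᵢ| admit no nontrivial {-1,0,1}-relation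
-- on the support of v, since it would yield a shift exhibiting v as a midpoint.
vertex-relationFree : ∀ {n} {a : Fin n → ℤ} {b} {v : Pt n} → IsVertex a b v →
  RelationFree (λ i → ∣ a i ∣) (zeroPattern v)
vertex-relationFree {a = a} {b} {v} vertex t t≤1 t-off t-rel j with t j ℤ.≟ + 0
... | yes tⱼ≡0 = tⱼ≡0
... | no  tⱼ≢0 = ⊥-elim (proj₂ vertex
      (midpoint-of-shifts {a = a} {b} x-feas v≡x w≤1 w-off aw≡0 (alignSign-nonzero (a j) tⱼ≢0)))
  where
  v-int : IntegerPoint a b v
  v-int = vertex-integral {a = a} {b} vertex
  x : Fin _ → ℤ
  x = proj₁ v-int
  x-feas : IntFeasible a b x
  x-feas = proj₁ (proj₂ v-int)
  v≡x : ∀ i → v i ≡ embed (x i)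
  v≡x = proj₂ (proj₂ v-int)
  w : Fin _ → ℤ
  w i = alignSign (a i) (t i)
  w≤1 : ∀ i → ∣ w i ∣ ≤ 1
  w≤1 i = subst (_≤ 1) (sym (alignSign-∣∣ (a i) (t i))) (t≤1 i)
  w-off : ∀ i → x i ≡ + 0 → w i ≡ + 0
  w-off i xᵢ≡0 = alignSign-zero (a i) (t-off i (dec-true (v i ℚ.≟ 0ℚ) (trans (v≡x i) (cong embed xᵢ≡0))))
  aw≡0 : dot a w ≡ + 0
  aw≡0 = trans (dot-cong {a = a} {w} {asℤ (λ i → ∣ a i ∣)} {t} (λ i → alignSign-* (a i) (t i))) t-rel

suppSize-zeroPattern : ∀ {n} (v : Pt n) → suppSize v ≡ supportCount (zeroPattern v)
suppSize-zeroPattern {zero}  v = refl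
suppSize-zeroPattern {suc n} v =
  cong (λ k → (if zeroPattern v zero then 0 else 1) + k) (suppSize-zeroPattern (v ∘ suc))

normInf-bound : ∀ {n} (a : Fin n → ℤ) i → ∣ a i ∣ ≤ normInf a
normInf-bound a zero    = m≤m⊔n _ _
normInf-bound a (suc i) = ≤-trans (normInf-bound (a ∘ suc) i) (m≤n⊔m _ _)

normInf-positive : ∀ {n} (a : Fin n → ℤ) → NonZeroVec a → 1 ≤ normInf a
normInf-positive a (i , aᵢ≢0) =
  ≤-trans (n≢0⇒n>0 (λ ∣aᵢ∣≡0 → aᵢ≢0 (ℤ.∣i∣≡0⇒i≡0 ∣aᵢ∣≡0))) (normInf-bound a i)

cube-ratio : ∀ m → (5 + m) ^ 3 ≤ 2 * (4 + m) ^ 3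
cube-ratio m = subst ((5 + m) ^ 3 ≤_) (sym (expand m)) (m≤m+n _ _)
  where
  open ℕ-Poly
  expand : ∀ k → 2 * (4 + k) ^ 3 ≡ (5 + k) ^ 3 + (k ^ 3 + 9 * k ^ 2 + 21 * k + 3)
  expand = solve 1 (λ k → con 2 :* (con 4 :+ k) :^ 3 :=
                          (con 5 :+ k) :^ 3 :+ (k :^ 3 :+ con 9 :* k :^ 2 :+ con 21 :* k :+ con 3)) refl

cube-below-exp : ∀ s → 1000 * suc s ^ 3 ≤ 13824 * 2 ^ s
cube-below-exp 0 = ≤ᵇ⇒≤ _ _ tt
cube-below-exp 1 = ≤ᵇ⇒≤ _ _ tt
cube-below-exp 2 = ≤ᵇ⇒≤ _ _ tt
cube-below-exp 3 = ≤ᵇ⇒≤ _ _ tt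
cube-below-exp (suc s@(suc (suc (suc m)))) = begin
  1000 * (5 + m) ^ 3          ≤⟨ *-monoʳ-≤ 1000 (cube-ratio m) ⟩
  1000 * (2 * (4 + m) ^ 3)    ≡⟨ swap 1000 2 ((4 + m) ^ 3) ⟩
  2 * (1000 * suc s ^ 3)    ≤⟨ *-monoʳ-≤ 2 (cube-below-exp s) ⟩
  2 * (13824 * 2 ^ s)         ≡⟨ swap 2 13824 (2 ^ s) ⟩
  13824 * 2 ^ suc s           ∎
  where
  open ≤-Reasoning
  open ℕ-Poly
  swap : ∀ p q r → p * (q * r) ≡ q * (p * r)
  swap = solve 3 (λ p q r → p :* (q :* r) := q :* (p :* r)) refl

four-pow : ∀ s → 4 ^ s ≡ 2 ^ s * 2 ^ s
four-pow zero    = refl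
four-pow (suc s) = trans (cong (4 *_) (four-pow s)) (regroup (2 ^ s))
  where
  open ℕ-Poly
  regroup : ∀ p → 4 * (p * p) ≡ (2 * p) * (2 * p)
  regroup = solve 1 (λ p → con 4 :* (p :* p) := (con 2 :* p) :* (con 2 :* p)) refl

-- The arithmetic content of the corollary: 2^s ≤ s·Δ + 1 with Δ ≥ 1 implies
-- 4^s ≤ (2.4·Δ)³ (i.e. s ≤ (3/2) log(2.4·Δ)), written with integer coefficients.
exp-bound⇒log-bound : ∀ s Δ → 1 ≤ Δ → 2 ^ s ≤ suc (s * Δ) → 1000 * 4 ^ s ≤ 13824 * Δ ^ 3
exp-bound⇒log-bound s Δ Δ≥1 2^s≤ = *-cancelʳ-≤ _ _ (suc s ^ 3) {{m^n≢0 (suc s) 3}} (begin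
  1000 * 4 ^ s * suc s ^ 3            ≡⟨ cong (λ q → 1000 * q * suc s ^ 3) (four-pow s) ⟩
  1000 * (2 ^ s * 2 ^ s) * suc s ^ 3  ≡⟨ regroup (2 ^ s) (suc s ^ 3) ⟩
  1000 * suc s ^ 3 * (2 ^ s * 2 ^ s)  ≤⟨ *-monoˡ-≤ (2 ^ s * 2 ^ s) (cube-below-exp s) ⟩
  13824 * 2 ^ s * (2 ^ s * 2 ^ s)     ≡⟨ cube (2 ^ s) ⟩
  13824 * (2 ^ s) ^ 3                 ≤⟨ *-monoʳ-≤ 13824 (^-monoˡ-≤ 3 2^s≤[s+1]Δ) ⟩
  13824 * (suc s * Δ) ^ 3             ≡⟨ split (suc s) Δ ⟩
  13824 * Δ ^ 3 * suc s ^ 3           ∎)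
  where
  open ≤-Reasoning
  open ℕ-Poly
  2^s≤[s+1]Δ : 2 ^ s ≤ suc s * Δ
  2^s≤[s+1]Δ = ≤-trans 2^s≤ (+-monoˡ-≤ (s * Δ) Δ≥1)
  regroup : ∀ p c → 1000 * (p * p) * c ≡ 1000 * c * (p * p)
  regroup = solve 2 (λ p c → con 1000 :* (p :* p) :* c := con 1000 :* c :* (p :* p)) refl
  cube : ∀ p → 13824 * p * (p * p) ≡ 13824 * p ^ 3
  cube = solve 1 (λ p → con 13824 :* p :* (p :* p) := con 13824 :* p :^ 3) refl
  split : ∀ k d → 13824 * (k * d) ^ 3 ≡ 13824 * d ^ 3 * k ^ 3
  split = solve 2 (λ k d → con 13824 :* (k :* d) :^ 3 := con 13824 :* d :^ 3 :* k :^ 3) refl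

corollary6 : (n : ℕ) (a : Fin n → ℤ) (b : ℤ) → NonZeroVec a →
    (v : Pt n) → IsVertex a b v →
    1000 * 4 ^ suppSize v ≤ 13824 * normInf a ^ 3
corollary6 n a b a≢0 v vertex =
  subst (λ s → 1000 * 4 ^ s ≤ 13824 * normInf a ^ 3) (sym (suppSize-zeroPattern v))
    (exp-bound⇒log-bound (supportCount (zeroPattern v)) (normInf a) (normInf-positive a a≢0)
      (relationFree-bound (λ i → ∣ a i ∣) (zeroPattern v) (normInf a) (normInf-bound a)
        (vertex-relationFree {a = a} {b} vertex)))
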